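{- For all positive integers $m,n$, not both equal to $1$, the grid graph $P_n\square P_m$ is prime.
   Context: $P_k$ is the path on $k$ vertices and $\square$ is the Cartesian product of graphs. All graphs are finite, simple and undirected. For graphs $H,K$ on the vertex set $V(G)$, $G$ is factored into $H$ and $K$ if $A=BC$, where $A,B,C$ are the adjacency matrices of $G,H,K$ with respect to one common ordering of the vertices. $G$ is prime if in every factorization of $G$ into $H$ and $K$, one of $H$, $K$ is a perfect matching (a $1$-regular spanning graph); a graph with no factorization is prime. -}

module Defs where

open import Data.Bool using (Bool; true; false; _∨_; _∧_; if_then_else_)
open import Data.Nat using (ℕ; zero; suc; _+_; _*_; _≡ᵇ_)
open import Data.Fin using (Fin; zero; suc; toℕ; remQuot)
open import Data.Product using (_×_; _,_)
open import Data.Sum using (_⊎_)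
open import Relation.Binary.PropositionalEquality using (_≡_)

Graph : ℕ → Set
Graph N = Fin N → Fin N → Bool

IsSimple : ∀ {N} → Graph N → Set
IsSimple {N} G = (∀ (i j : Fin N) → G i j ≡ G j i) × (∀ (i : Fin N) → G i i ≡ false)

adjMatrix : ∀ {N} → Graph N → Fin N → Fin N → ℕ
adjMatrix G i j = if G i j then 1 else 0

Σ : ∀ {N} → (Fin N → ℕ) → ℕ
Σ {zero} f = 0
Σ {suc N} f = f zero + Σ (λ k → f (suc k))

Factors : ∀ {N} → Graph N → Graph N → Graph N → Set
Factors {N} G H K =
  ∀ (i j : Fin N) → adjMatrix G i j ≡ Σ (λ k → adjMatrix H i k * adjMatrix K k j)

degree : ∀ {N} → Graph N → Fin N → ℕ
degree G i = Σ (λ k → adjMatrix G i k)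

-- perfect matching = 1-regular spanning graph
IsPerfectMatching : ∀ {N} → Graph N → Set
IsPerfectMatching {N} H = ∀ (i : Fin N) → degree H i ≡ 1

-- G is prime: in every factorization of G into simple graphs H, K on V(G),
-- one of H, K is a perfect matching (vacuous if there is no factorization).
IsPrime : ∀ {N} → Graph N → Set
IsPrime {N} G = ∀ (H K : Graph N) → IsSimple H → IsSimple K →
  Factors G H K → IsPerfectMatching H ⊎ IsPerfectMatching K

_=ᶠ_ : ∀ {k} → Fin k → Fin k → Bool
i =ᶠ j = toℕ i ≡ᵇ toℕ j

pathGraph : (k : ℕ) → Graph k
pathGraph k i j = (suc (toℕ i) ≡ᵇ toℕ j) ∨ (suc (toℕ j) ≡ᵇ toℕ i)

-- Cartesian product G □ H on the vertex set Fin (n * m) ≅ Fin n × Fin m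
-- (identification via remQuot)
cartesian : ∀ {n m} → Graph n → Graph m → Graph (n * m)
cartesian {n} {m} G H u v with remQuot {n} m u | remQuot {n} m v
... | (a , b) | (c , d) = ((a =ᶠ c) ∧ H b d) ∨ (G a c ∧ (b =ᶠ d))

grid : (n m : ℕ) → Graph (n * m)
grid n m = cartesian (pathGraph n) (pathGraph m)

-- If A = BC for the adjacency matrices of symmetric graphs G, H, K, then transposing gives
-- A = CB as well, so AC = CBC = CA.  Reading (AC)ᵢₖ = (CA)ᵢₖ along an H-edge i k shows that
-- K-degrees are constant along H-edges, and symmetrically H-degrees along K-edges.  Hence
-- deg G = deg H · deg K, and every G-edge x y, realised as a path x –H– l –K– y, yields a
-- vertex l carrying the H-degree of y and the K-degree of x.
--
-- In the grid every degree lies in 1..4.  A vertex where both H and K have degree ≥ 2 has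
-- degree 4, and this property travels along its column to the boundary row, whose vertices
-- have degree ≤ 3; so there is no such vertex.  Consequently, if H has degree ≥ 2 somewhere,
-- it has degree ≥ 2 at every vertex of degree ≥ 2 (these vertices are connected), and then K
-- has degree ≥ 2 nowhere, i.e. K is a perfect matching.

module Submission where

open import Defs
open import Data.Nat using (ℕ; _≤_)
open import Data.Product using (_×_)
open import Relation.Binary.PropositionalEquality using (_≡_)
open import Relation.Nullary using (¬_)

open import Data.Bool using (Bool; true; false; T; _∧_; _∨_; if_then_else_)
open import Data.Bool.Properties using (∨-comm; T-∧; T-∨)
open import Data.Empty using (⊥; ⊥-elim)
open import Data.Fin as Fin using (Fin; toℕ; fromℕ<; combine; remQuot; _↑ˡ_; _↑ʳ_)
open import Data.Fin.Properties
  using (toℕ-injective; toℕ<n; toℕ-fromℕ<; remQuot-combine; combine-remQuot; all?; ¬∀⟶∃¬)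
open import Data.Nat
  using (zero; suc; _+_; _*_; _<_; _≡ᵇ_; _<ᵇ_; z≤n; s≤s; z<s; s≤s⁻¹; >-nonZero)
open import Data.Nat.Properties
open import Algebra.Properties.Semiring.Sum +-*-semiring
open import Data.Product using (∃; _,_; proj₁; uncurry)
open import Data.Sum using (_⊎_; inj₁; inj₂; [_,_]′)
open import Data.Unit using (tt)
open import Function using (_∘_)
open import Function.Bundles using (Equivalence)
open import Relation.Binary.PropositionalEquality
  using (_≢_; refl; sym; trans; cong; cong₂; subst; module ≡-Reasoning)
open import Relation.Nullary using (yes; no)

-- adjMatrix G i j is definitionally ⟦ G i j ⟧.
⟦_⟧ : Bool → ℕ
⟦ b ⟧ = if b then 1 else 0

⟦⟧≤1 : ∀ b → ⟦ b ⟧ ≤ 1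
⟦⟧≤1 true  = ≤-refl
⟦⟧≤1 false = z≤n

T⇒⟦⟧≡1 : ∀ {b} → T b → ⟦ b ⟧ ≡ 1
T⇒⟦⟧≡1 {true} _ = refl

T⇒⟦⟧>0 : ∀ {b} → T b → 0 < ⟦ b ⟧
T⇒⟦⟧>0 {true} _ = z<s

⟦⟧>0⇒T : ∀ {b} → 0 < ⟦ b ⟧ → T b
⟦⟧>0⇒T {true} _ = tt

⟦∧⟧ : ∀ a b → ⟦ a ∧ b ⟧ ≡ ⟦ a ⟧ * ⟦ b ⟧
⟦∧⟧ true  b = sym (+-identityʳ ⟦ b ⟧)
⟦∧⟧ false b = refl

⟦∨⟧ : ∀ a b → (T a → T b → ⊥) → ⟦ a ∨ b ⟧ ≡ ⟦ a ⟧ + ⟦ b ⟧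
⟦∨⟧ true  true  disjoint = ⊥-elim (disjoint tt tt)
⟦∨⟧ true  false _ = refl
⟦∨⟧ false b     _ = refl

2≤⟦⟧+⟦⟧⇒Tʳ : ∀ a b → 2 ≤ ⟦ a ⟧ + ⟦ b ⟧ → T b
2≤⟦⟧+⟦⟧⇒Tʳ true  true  _ = tt
2≤⟦⟧+⟦⟧⇒Tʳ true  false (s≤s ())
2≤⟦⟧+⟦⟧⇒Tʳ false true  _ = tt
2≤⟦⟧+⟦⟧⇒Tʳ false false ()

⟦⟧≤*⟦⟧ : ∀ b {n} → (T b → 0 < n) → ⟦ b ⟧ ≤ n * ⟦ b ⟧
⟦⟧≤*⟦⟧ true  {n} n>0 = subst (1 ≤_) (sym (*-identityʳ n)) (n>0 tt)
⟦⟧≤*⟦⟧ false _ = z≤n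

⟦⟧*-cong : ∀ b {x y} → (T b → x ≡ y) → ⟦ b ⟧ * x ≡ ⟦ b ⟧ * y
⟦⟧*-cong true  x≡y = cong (_+ 0) (x≡y tt)
⟦⟧*-cong false _ = refl

Σ≡∑ : ∀ {N} (f : Fin N → ℕ) → Σ f ≡ ∑[ i < N ] f i
Σ≡∑ {zero}  f = refl
Σ≡∑ {suc N} f = cong (f Fin.zero +_) (Σ≡∑ (λ i → f (Fin.suc i)))

∑-mono-≤ : ∀ {N} {f g : Fin N → ℕ} → (∀ i → f i ≤ g i) →
  ∑[ i < N ] f i ≤ ∑[ i < N ] g i
∑-mono-≤ {zero}  f≤g = z≤n
∑-mono-≤ {suc N} f≤g = +-mono-≤ (f≤g Fin.zero) (∑-mono-≤ (λ i → f≤g (Fin.suc i)))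

term≤∑ : ∀ {N} (f : Fin N → ℕ) i → f i ≤ ∑[ j < N ] f j
term≤∑ f Fin.zero    = m≤m+n _ _
term≤∑ f (Fin.suc i) = ≤-trans (term≤∑ (λ j → f (Fin.suc j)) i) (m≤n+m _ (f Fin.zero))

∑>0⇒∃>0 : ∀ {N} (f : Fin N → ℕ) → 0 < ∑[ i < N ] f i → ∃ λ i → 0 < f i
∑>0⇒∃>0 {suc N} f ∑>0 with f Fin.zero in f₀≡
... | suc _ = Fin.zero , subst (0 <_) (sym f₀≡) z<s
... | zero with ∑>0⇒∃>0 (λ i → f (Fin.suc i)) ∑>0
...   | i , fᵢ>0 = Fin.suc i , fᵢ>0

∑-↑ : ∀ a {b} (f : Fin (a + b) → ℕ) →
  ∑[ i < a + b ] f i ≡ ∑[ i < a ] f (i ↑ˡ b) + ∑[ j < b ] f (a ↑ʳ j)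
∑-↑ zero    f = refl
∑-↑ (suc a) f = trans (cong (f Fin.zero +_) (∑-↑ a (λ i → f (Fin.suc i))))
                      (sym (+-assoc (f Fin.zero) _ _))

∑-combine : ∀ n m (f : Fin (n * m) → ℕ) →
  ∑[ u < n * m ] f u ≡ ∑[ a < n ] ∑[ b < m ] f (combine a b)
∑-combine zero    m f = refl
∑-combine (suc n) m f =
  trans (∑-↑ m f)
        (cong (∑[ b < m ] f (b ↑ˡ n * m) +_) (∑-combine n m (λ u → f (m ↑ʳ u))))

∑-δ : ∀ {n} (a : Fin n) (f : Fin n → ℕ) → ∑[ c < n ] (⟦ a =ᶠ c ⟧ * f c) ≡ f a
∑-δ {suc n} Fin.zero    f =
  trans (cong₂ _+_ (+-identityʳ (f Fin.zero)) (sum-replicate-zero n)) (+-identityʳ _)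
∑-δ {suc n} (Fin.suc a) f = ∑-δ a (λ c → f (Fin.suc c))

∑-count : ∀ k t → ∑[ c < k ] ⟦ t ≡ᵇ toℕ c ⟧ ≡ ⟦ t <ᵇ k ⟧
∑-count zero    t       = refl
∑-count (suc k) zero    = cong suc (sum-replicate-zero k)
∑-count (suc k) (suc t) = ∑-count k t

Matrix : ℕ → Set
Matrix N = Fin N → Fin N → ℕ

infixl 7 _·_

_·_ : ∀ {N} → Matrix N → Matrix N → Matrix N
_·_ {N} X Y i j = ∑[ k < N ] (X i k * Y k j)

·-assoc : ∀ {N} (X Y Z : Matrix N) i j → ((X · Y) · Z) i j ≡ (X · (Y · Z)) i j
·-assoc {N} X Y Z i j = begin
  ∑[ l < N ] (∑[ k < N ] (X i k * Y k l) * Z l j)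
    ≡⟨ sum-cong-≗ (λ l → *-distribʳ-sum (Z l j) (λ k → X i k * Y k l)) ⟩
  ∑[ l < N ] ∑[ k < N ] (X i k * Y k l * Z l j)
    ≡⟨ ∑-comm (λ l k → X i k * Y k l * Z l j) ⟩
  ∑[ k < N ] ∑[ l < N ] (X i k * Y k l * Z l j)
    ≡⟨ sum-cong-≗ (λ k → sum-cong-≗ (λ l → *-assoc (X i k) (Y k l) (Z l j))) ⟩
  ∑[ k < N ] ∑[ l < N ] (X i k * (Y k l * Z l j))
    ≡⟨ sum-cong-≗ (λ k → sym (*-distribˡ-sum (X i k) (λ l → Y k l * Z l j))) ⟩
  ∑[ k < N ] (X i k * ∑[ l < N ] (Y k l * Z l j)) ∎
  where open ≡-Reasoning

IsSymmetric : ∀ {N} → Graph N → Set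
IsSymmetric {N} G = ∀ (i j : Fin N) → G i j ≡ G j i

degree≡∑ : ∀ {N} (G : Graph N) i → degree G i ≡ ∑[ k < N ] ⟦ G i k ⟧
degree≡∑ G i = Σ≡∑ (adjMatrix G i)

module Factorization {N} {G H K : Graph N}
  (G-sym : IsSymmetric G) (H-sym : IsSymmetric H) (K-sym : IsSymmetric K)
  (G≡HK : Factors G H K) where

  private
    A B C : Matrix N
    A = adjMatrix G
    B = adjMatrix H
    C = adjMatrix K

  A≡BC : ∀ i j → A i j ≡ (B · C) i j
  A≡BC i j = trans (G≡HK i j) (Σ≡∑ (λ k → B i k * C k j))

  A≡CB : ∀ i j → A i j ≡ (C · B) i j
  A≡CB i j = begin
    A i j               ≡⟨ cong ⟦_⟧ (G-sym i j) ⟩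
    A j i               ≡⟨ A≡BC j i ⟩
    ∑[ k < N ] (B j k * C k i)
      ≡⟨ sum-cong-≗ (λ k → trans (*-comm (B j k) (C k i))
                                  (cong₂ _*_ (cong ⟦_⟧ (K-sym k i)) (cong ⟦_⟧ (H-sym j k)))) ⟩
    ∑[ k < N ] (C i k * B k j) ∎
    where open ≡-Reasoning

  factors-comm : Factors G K H
  factors-comm i j = trans (A≡CB i j) (sym (Σ≡∑ (λ k → C i k * B k j)))

  AC≡CA : ∀ i j → (A · C) i j ≡ (C · A) i j
  AC≡CA i j = begin
    (A · C) i j       ≡⟨ sum-cong-≗ (λ l → cong (_* C l j) (A≡CB i l)) ⟩
    (C · B · C) i j   ≡⟨ ·-assoc C B C i j ⟩
    (C · (B · C)) i j ≡⟨ sum-cong-≗ (λ l → cong (C i l *_) (sym (A≡BC l j))) ⟩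
    (C · A) i j       ∎
    where open ≡-Reasoning

  HK-path⇒G-edge : ∀ {i u j} → T (H i u) → T (K u j) → T (G i j)
  HK-path⇒G-edge {i} {u} {j} Hiu Kuj = ⟦⟧>0⇒T (subst (_≤ A i j) weight≡1 weight≤A)
    where
    weight≡1 : B i u * C u j ≡ 1
    weight≡1 = cong₂ _*_ (T⇒⟦⟧≡1 Hiu) (T⇒⟦⟧≡1 Kuj)
    weight≤A : B i u * C u j ≤ A i j
    weight≤A = subst (B i u * C u j ≤_) (sym (A≡BC i j)) (term≤∑ (λ k → B i k * C k j) u)

  G-edge⇒HK-path : ∀ {i j} → T (G i j) → ∃ λ u → T (H i u) × T (K u j)
  G-edge⇒HK-path {i} {j} Gij =
    let u , weight>0 = ∑>0⇒∃>0 (λ k → B i k * C k j)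
                                (subst (0 <_) (A≡BC i j) (T⇒⟦⟧>0 Gij))
    in  u , Equivalence.to T-∧ (⟦⟧>0⇒T (subst (0 <_) (sym (⟦∧⟧ (H i u) (K u j))) weight>0))

  -- Each K-neighbour j of k gives the G-edge i j (via i –H– k –K– j); since A ≤ 1 entrywise,
  -- AC = CA bounds their number by the K-degree of i.
  H-edge⇒K-degree≤ : ∀ {i k} → T (H i k) → degree K k ≤ degree K i
  H-edge⇒K-degree≤ {i} {k} Hik = begin
    degree K k                  ≡⟨ degree≡∑ K k ⟩
    ∑[ j < N ] C k j            ≡⟨ sum-cong-≗ (λ j → cong ⟦_⟧ (K-sym k j)) ⟩
    ∑[ j < N ] C j k            ≤⟨ ∑-mono-≤ (λ j → ⟦⟧≤*⟦⟧ (K j k) (A>0 j)) ⟩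
    (A · C) i k                 ≡⟨ AC≡CA i k ⟩
    (C · A) i k                 ≤⟨ ∑-mono-≤ (λ l → *-monoʳ-≤ (C i l) (⟦⟧≤1 (G l k))) ⟩
    ∑[ l < N ] (C i l * 1)      ≡⟨ sum-cong-≗ (λ l → *-identityʳ (C i l)) ⟩
    ∑[ l < N ] C i l            ≡⟨ degree≡∑ K i ⟨
    degree K i                  ∎
    where
    open ≤-Reasoning
    A>0 : ∀ j → T (K j k) → 0 < A i j
    A>0 j Kjk = T⇒⟦⟧>0 (HK-path⇒G-edge Hik (subst T (K-sym j k) Kjk))

  H-edge⇒K-degree≡ : ∀ {i k} → T (H i k) → degree K i ≡ degree K k
  H-edge⇒K-degree≡ {i} {k} Hik =
    ≤-antisym (H-edge⇒K-degree≤ (subst T (H-sym i k) Hik)) (H-edge⇒K-degree≤ Hik)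

  degree-multiplicative : ∀ v → degree G v ≡ degree H v * degree K v
  degree-multiplicative v = begin
    degree G v                               ≡⟨ degree≡∑ G v ⟩
    ∑[ j < N ] A v j                         ≡⟨ sum-cong-≗ (A≡BC v) ⟩
    ∑[ j < N ] ∑[ u < N ] (B v u * C u j)    ≡⟨ ∑-comm (λ j u → B v u * C u j) ⟩
    ∑[ u < N ] ∑[ j < N ] (B v u * C u j)    ≡⟨ sum-cong-≗ (λ u → *-distribˡ-sum (B v u) (C u)) ⟨
    ∑[ u < N ] (B v u * ∑[ j < N ] C u j)    ≡⟨ sum-cong-≗ K-degree-const ⟩
    ∑[ u < N ] (B v u * degree K v)          ≡⟨ *-distribʳ-sum (degree K v) (B v) ⟨
    ∑[ u < N ] B v u * degree K v            ≡⟨ cong (_* degree K v) (degree≡∑ H v) ⟨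
    degree H v * degree K v                  ∎
    where
    open ≡-Reasoning
    K-degree-const : ∀ u → B v u * ∑[ j < N ] C u j ≡ B v u * degree K v
    K-degree-const u = ⟦⟧*-cong (H v u)
      (λ Hvu → trans (sym (degree≡∑ K u)) (sym (H-edge⇒K-degree≡ Hvu)))

edge⇒mixed-degrees : ∀ {N} {G H K : Graph N} →
  IsSymmetric G → IsSymmetric H → IsSymmetric K → Factors G H K →
  ∀ {x y} → T (G x y) → ∃ λ l → degree H l ≡ degree H y × degree K l ≡ degree K x
edge⇒mixed-degrees G-sym H-sym K-sym G≡HK Gxy =
  let l , Hxl , Kly = G-edge⇒HK-path Gxy
  in  l , Swapped.H-edge⇒K-degree≡ Kly , sym (H-edge⇒K-degree≡ Hxl)
  where
  open Factorization G-sym H-sym K-sym G≡HK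
  module Swapped = Factorization G-sym K-sym H-sym factors-comm

≡ᵇ-sym : ∀ m n → (m ≡ᵇ n) ≡ (n ≡ᵇ m)
≡ᵇ-sym zero    zero    = refl
≡ᵇ-sym zero    (suc n) = refl
≡ᵇ-sym (suc m) zero    = refl
≡ᵇ-sym (suc m) (suc n) = ≡ᵇ-sym m n

=ᶠ-sym : ∀ {k} (a c : Fin k) → (a =ᶠ c) ≡ (c =ᶠ a)
=ᶠ-sym a c = ≡ᵇ-sym (toℕ a) (toℕ c)

=ᶠ-refl : ∀ {k} (a : Fin k) → T (a =ᶠ a)
=ᶠ-refl a = ≡⇒≡ᵇ (toℕ a) (toℕ a) refl

=ᶠ⇒≡ : ∀ {k} {a c : Fin k} → T (a =ᶠ c) → a ≡ c
=ᶠ⇒≡ {a = a} {c} a=c = toℕ-injective (≡ᵇ⇒≡ (toℕ a) (toℕ c) a=c)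

path-sym : ∀ k → IsSymmetric (pathGraph k)
path-sym k x y = ∨-comm (suc (toℕ x) ≡ᵇ toℕ y) (suc (toℕ y) ≡ᵇ toℕ x)

path-loopless : ∀ k (x : Fin k) → ¬ T (pathGraph k x x)
path-loopless k x Pxx = [ no-loop , no-loop ]′ (Equivalence.to T-∨ Pxx)
  where
  no-loop : ¬ T (suc (toℕ x) ≡ᵇ toℕ x)
  no-loop p = 1+n≢n (≡ᵇ⇒≡ (suc (toℕ x)) (toℕ x) p)

path-edge : ∀ {k} {x y : Fin k} → suc (toℕ x) ≡ toℕ y → T (pathGraph k x y)
path-edge {x = x} {y} x+1≡y =
  Equivalence.from T-∨ (inj₁ (≡⇒≡ᵇ (suc (toℕ x)) (toℕ y) x+1≡y))

path-edge⁻ : ∀ {k} {x y : Fin k} → suc (toℕ y) ≡ toℕ x → T (pathGraph k x y)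
path-edge⁻ {x = x} {y} y+1≡x =
  Equivalence.from T-∨ (inj₂ (≡⇒≡ᵇ (suc (toℕ y)) (toℕ x) y+1≡x))

∑-count-pred : ∀ k t → t ≤ k → ∑[ c < k ] ⟦ t ≡ᵇ suc (toℕ c) ⟧ ≡ ⟦ 0 <ᵇ t ⟧
∑-count-pred k zero    _   = sum-replicate-zero k
∑-count-pred k (suc t) t<k = trans (∑-count k t) (T⇒⟦⟧≡1 (<⇒<ᵇ t<k))

degree-path : ∀ k (x : Fin k) →
  degree (pathGraph k) x ≡ ⟦ suc (toℕ x) <ᵇ k ⟧ + ⟦ 0 <ᵇ toℕ x ⟧
degree-path k x = begin
  degree (pathGraph k) x
    ≡⟨ degree≡∑ (pathGraph k) x ⟩
  ∑[ y < k ] ⟦ (suc (toℕ x) ≡ᵇ toℕ y) ∨ (suc (toℕ y) ≡ᵇ toℕ x) ⟧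
    ≡⟨ sum-cong-≗ {k} (λ y → ⟦∨⟧ _ _ (two-sided y)) ⟩
  ∑[ y < k ] (⟦ suc (toℕ x) ≡ᵇ toℕ y ⟧ + ⟦ suc (toℕ y) ≡ᵇ toℕ x ⟧)
    ≡⟨ ∑-distrib-+ {k} (λ y → ⟦ suc (toℕ x) ≡ᵇ toℕ y ⟧) (λ y → ⟦ suc (toℕ y) ≡ᵇ toℕ x ⟧) ⟩
  ∑[ y < k ] ⟦ suc (toℕ x) ≡ᵇ toℕ y ⟧ + ∑[ y < k ] ⟦ suc (toℕ y) ≡ᵇ toℕ x ⟧
    ≡⟨ cong₂ _+_ (∑-count k (suc (toℕ x)))
                 (trans (sum-cong-≗ {k} (λ y → cong ⟦_⟧ (≡ᵇ-sym (suc (toℕ y)) (toℕ x))))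
                        (∑-count-pred k (toℕ x) (<⇒≤ (toℕ<n x)))) ⟩
  ⟦ suc (toℕ x) <ᵇ k ⟧ + ⟦ 0 <ᵇ toℕ x ⟧ ∎
  where
  open ≡-Reasoning
  two-sided : ∀ y → T (suc (toℕ x) ≡ᵇ toℕ y) → T (suc (toℕ y) ≡ᵇ toℕ x) → ⊥
  two-sided y x+1≡y y+1≡x =
    m≢1+n+m (toℕ x) {1} (trans (sym (≡ᵇ⇒≡ (suc (toℕ y)) (toℕ x) y+1≡x))
                                (cong suc (sym (≡ᵇ⇒≡ (suc (toℕ x)) (toℕ y) x+1≡y))))

edge⇒degree>0 : ∀ {N} (G : Graph N) {x y} → T (G x y) → 0 < degree G x
edge⇒degree>0 {N} G {x} {y} Gxy =
  subst (0 <_) (sym (degree≡∑ G x)) (≤-trans (T⇒⟦⟧>0 Gxy) (term≤∑ (λ k → ⟦ G x k ⟧) y))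

path-degree≤2 : ∀ k (x : Fin k) → degree (pathGraph k) x ≤ 2
path-degree≤2 k x = subst (_≤ 2) (sym (degree-path k x))
  (+-mono-≤ (⟦⟧≤1 (suc (toℕ x) <ᵇ k)) (⟦⟧≤1 (0 <ᵇ toℕ x)))

path-degree>0 : ∀ k (x : Fin k) → 2 ≤ k → 0 < degree (pathGraph k) x
path-degree>0 k x 2≤k = subst (0 <_) (sym (degree-path k x)) (positive (toℕ x))
  where
  positive : ∀ t → 0 < ⟦ suc t <ᵇ k ⟧ + ⟦ 0 <ᵇ t ⟧
  positive zero    = ≤-trans (T⇒⟦⟧>0 (<⇒<ᵇ 2≤k)) (m≤m+n _ _)
  positive (suc t) = m≤n+m 1 ⟦ suc (suc t) <ᵇ k ⟧

Interior : ∀ {k} → Fin k → Set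
Interior {k} x = 0 < toℕ x × suc (toℕ x) < k

interior⇒2≤path-degree : ∀ k (x : Fin k) → Interior x → 2 ≤ degree (pathGraph k) x
interior⇒2≤path-degree k x (0<x , x+1<k) =
  ≤-reflexive (sym (trans (degree-path k x)
                          (cong₂ _+_ (T⇒⟦⟧≡1 (<⇒<ᵇ x+1<k)) (T⇒⟦⟧≡1 (<⇒<ᵇ 0<x)))))

2≤path-degree⇒0< : ∀ k (x : Fin k) → 2 ≤ degree (pathGraph k) x → 0 < toℕ x
2≤path-degree⇒0< k x 2≤deg =
  <ᵇ⇒< 0 (toℕ x)
    (2≤⟦⟧+⟦⟧⇒Tʳ (suc (toℕ x) <ᵇ k) _ (subst (2 ≤_) (degree-path k x) 2≤deg))

between⇒interior : ∀ {k} (a x b : Fin k) → toℕ a < toℕ x → toℕ x < toℕ b → Interior x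
between⇒interior a x b a<x x<b = ≤-<-trans z≤n a<x , ≤-<-trans x<b (toℕ<n b)

module PathWalk {k} (R : Fin k → Set) (t : Fin k)
  (step : ∀ c c' → T (pathGraph k c c') → Interior c' ⊎ c' ≡ t → R c → R c') where

  move : ∀ c c' → T (pathGraph k c c') → (toℕ c' ≢ toℕ t → Interior c') → R c → R c'
  move c c' c~c' interior with toℕ c' ≟ toℕ t
  ... | yes c'≡t = step c c' c~c' (inj₂ (toℕ-injective c'≡t))
  ... | no  c'≢t = step c c' c~c' (inj₁ (interior c'≢t))

  walk-up : ∀ d c → toℕ c + d ≡ toℕ t → R c → R t
  walk-up zero    c c+0≡t Rc = subst R (toℕ-injective (trans (sym (+-identityʳ (toℕ c))) c+0≡t)) Rc
  walk-up (suc d) c c+[1+d]≡t Rc = walk-up d c' c'+d≡t (move c c' (path-edge (sym c'≡c+1)) interior Rc)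
    where
    c+1+d≡t : suc (toℕ c + d) ≡ toℕ t
    c+1+d≡t = trans (sym (+-suc (toℕ c) d)) c+[1+d]≡t
    c+1<k : suc (toℕ c) < k
    c+1<k = ≤-<-trans (s≤s (m≤m+n (toℕ c) d)) (subst (_< k) (sym c+1+d≡t) (toℕ<n t))
    c' : Fin k
    c' = fromℕ< c+1<k
    c'≡c+1 : toℕ c' ≡ suc (toℕ c)
    c'≡c+1 = toℕ-fromℕ< c+1<k
    c'+d≡t : toℕ c' + d ≡ toℕ t
    c'+d≡t = trans (cong (_+ d) c'≡c+1) c+1+d≡t
    interior : toℕ c' ≢ toℕ t → Interior c'
    interior c'≢t = between⇒interior c c' t (≤-reflexive (sym c'≡c+1))
      (≤∧≢⇒< (subst (toℕ c' ≤_) c'+d≡t (m≤m+n (toℕ c') d)) c'≢t)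

  walk-down : ∀ d c → toℕ t + d ≡ toℕ c → R c → R t
  walk-down zero    c t+0≡c Rc = subst R (toℕ-injective (trans (sym t+0≡c) (+-identityʳ (toℕ t)))) Rc
  walk-down (suc d) c t+[1+d]≡c Rc = walk-down d c' t+d≡c' (move c c' (path-edge⁻ c'+1≡c) interior Rc)
    where
    t+d+1≡c : suc (toℕ t + d) ≡ toℕ c
    t+d+1≡c = trans (sym (+-suc (toℕ t) d)) t+[1+d]≡c
    t+d<k : toℕ t + d < k
    t+d<k = <-trans (≤-reflexive t+d+1≡c) (toℕ<n c)
    c' : Fin k
    c' = fromℕ< t+d<k
    t+d≡c' : toℕ t + d ≡ toℕ c'
    t+d≡c' = sym (toℕ-fromℕ< t+d<k)
    c'+1≡c : suc (toℕ c') ≡ toℕ c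
    c'+1≡c = trans (cong suc (sym t+d≡c')) t+d+1≡c
    interior : toℕ c' ≢ toℕ t → Interior c'
    interior c'≢t = between⇒interior t c' c
      (≤∧≢⇒< (subst (toℕ t ≤_) t+d≡c' (m≤m+n (toℕ t) d)) (c'≢t ∘ sym)) (≤-reflexive c'+1≡c)

  path-walk : ∀ s → R s → R t
  path-walk s Rs with ≤-total (toℕ s) (toℕ t)
  ... | inj₁ s≤t = let d , s+d≡t = m≤n⇒∃[o]m+o≡n s≤t in walk-up d s s+d≡t Rs
  ... | inj₂ t≤s = let d , t+d≡s = m≤n⇒∃[o]m+o≡n t≤s in walk-down d s t+d≡s Rs

combine-elim : ∀ {n m} (P : Fin (n * m) → Set) → (∀ a b → P (combine a b)) → ∀ u → P u
combine-elim {n} {m} P P-combine u =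
  subst P (combine-remQuot {n} m u) (uncurry P-combine (remQuot {n} m u))

module _ {n m} (G : Graph n) (H : Graph m) where

  cartesian-combine : ∀ a b c d →
    cartesian G H (combine a b) (combine c d) ≡ ((a =ᶠ c) ∧ H b d) ∨ (G a c ∧ (b =ᶠ d))
  cartesian-combine a b c d = cong₂ edge (remQuot-combine a b) (remQuot-combine c d)
    where
    edge : Fin n × Fin m → Fin n × Fin m → Bool
    edge (a , b) (c , d) = ((a =ᶠ c) ∧ H b d) ∨ (G a c ∧ (b =ᶠ d))

  cartesian-sym : IsSymmetric G → IsSymmetric H → IsSymmetric (cartesian G H)
  cartesian-sym G-sym H-sym = combine-elim _ λ a b → combine-elim _ λ c d → begin
    cartesian G H (combine a b) (combine c d)     ≡⟨ cartesian-combine a b c d ⟩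
    ((a =ᶠ c) ∧ H b d) ∨ (G a c ∧ (b =ᶠ d))
      ≡⟨ cong₂ _∨_ (cong₂ _∧_ (=ᶠ-sym a c) (H-sym b d))
                   (cong₂ _∧_ (G-sym a c) (=ᶠ-sym b d)) ⟩
    ((c =ᶠ a) ∧ H d b) ∨ (G c a ∧ (d =ᶠ b))       ≡⟨ cartesian-combine c d a b ⟨
    cartesian G H (combine c d) (combine a b)     ∎
    where open ≡-Reasoning

  cartesian-edgeʳ : ∀ a {b d} → T (H b d) → T (cartesian G H (combine a b) (combine a d))
  cartesian-edgeʳ a {b} {d} Hbd = subst T (sym (cartesian-combine a b a d))
    (Equivalence.from T-∨ (inj₁ (Equivalence.from T-∧ (=ᶠ-refl a , Hbd))))

  cartesian-edgeˡ : ∀ {a c} b → T (G a c) → T (cartesian G H (combine a b) (combine c b))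
  cartesian-edgeˡ {a} {c} b Gac = subst T (sym (cartesian-combine a b c b))
    (Equivalence.from T-∨ (inj₂ (Equivalence.from T-∧ (Gac , =ᶠ-refl b))))

  degree-cartesian : (∀ a → ¬ T (G a a)) →
    ∀ a b → degree (cartesian G H) (combine a b) ≡ degree G a + degree H b
  degree-cartesian G-loopless a b = begin
    degree (cartesian G H) (combine a b)
      ≡⟨ degree≡∑ (cartesian G H) (combine a b) ⟩
    ∑[ u < n * m ] ⟦ cartesian G H (combine a b) u ⟧
      ≡⟨ ∑-combine n m _ ⟩
    ∑[ c < n ] ∑[ d < m ] ⟦ cartesian G H (combine a b) (combine c d) ⟧
      ≡⟨ sum-cong-≗ (λ c → sum-cong-≗ (λ d → split c d)) ⟩
    ∑[ c < n ] ∑[ d < m ] (⟦ a =ᶠ c ⟧ * ⟦ H b d ⟧ + ⟦ G a c ⟧ * ⟦ b =ᶠ d ⟧)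
      ≡⟨ sum-cong-≗ (λ c → ∑-distrib-+ (λ d → ⟦ a =ᶠ c ⟧ * ⟦ H b d ⟧)
                                        (λ d → ⟦ G a c ⟧ * ⟦ b =ᶠ d ⟧)) ⟩
    ∑[ c < n ] (∑[ d < m ] (⟦ a =ᶠ c ⟧ * ⟦ H b d ⟧) + ∑[ d < m ] (⟦ G a c ⟧ * ⟦ b =ᶠ d ⟧))
      ≡⟨ sum-cong-≗ (λ c → cong₂ _+_ (sym (*-distribˡ-sum ⟦ a =ᶠ c ⟧ (λ d → ⟦ H b d ⟧)))
                                     (column c)) ⟩
    ∑[ c < n ] (⟦ a =ᶠ c ⟧ * ∑[ d < m ] ⟦ H b d ⟧ + ⟦ G a c ⟧)
      ≡⟨ ∑-distrib-+ (λ c → ⟦ a =ᶠ c ⟧ * ∑[ d < m ] ⟦ H b d ⟧) (λ c → ⟦ G a c ⟧) ⟩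
    ∑[ c < n ] (⟦ a =ᶠ c ⟧ * ∑[ d < m ] ⟦ H b d ⟧) + ∑[ c < n ] ⟦ G a c ⟧
      ≡⟨ cong₂ _+_ (∑-δ a (λ _ → ∑[ d < m ] ⟦ H b d ⟧)) (sym (degree≡∑ G a)) ⟩
    ∑[ d < m ] ⟦ H b d ⟧ + degree G a
      ≡⟨ +-comm _ (degree G a) ⟩
    degree G a + ∑[ d < m ] ⟦ H b d ⟧
      ≡⟨ cong (degree G a +_) (degree≡∑ H b) ⟨
    degree G a + degree H b ∎
    where
    open ≡-Reasoning
    disjoint : ∀ c d → T ((a =ᶠ c) ∧ H b d) → T (G a c ∧ (b =ᶠ d)) → ⊥
    disjoint c d a=c∧Hbd Gac∧b=d = G-loopless a (subst (T ∘ G a) (sym a≡c) Gac)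
      where
      a≡c : a ≡ c
      a≡c = =ᶠ⇒≡ (proj₁ (Equivalence.to T-∧ a=c∧Hbd))
      Gac : T (G a c)
      Gac = proj₁ (Equivalence.to (T-∧ {G a c}) Gac∧b=d)
    split : ∀ c d → ⟦ cartesian G H (combine a b) (combine c d) ⟧ ≡
                    ⟦ a =ᶠ c ⟧ * ⟦ H b d ⟧ + ⟦ G a c ⟧ * ⟦ b =ᶠ d ⟧
    split c d = begin
      ⟦ cartesian G H (combine a b) (combine c d) ⟧
        ≡⟨ cong ⟦_⟧ (cartesian-combine a b c d) ⟩
      ⟦ ((a =ᶠ c) ∧ H b d) ∨ (G a c ∧ (b =ᶠ d)) ⟧
        ≡⟨ ⟦∨⟧ _ _ (disjoint c d) ⟩
      ⟦ (a =ᶠ c) ∧ H b d ⟧ + ⟦ G a c ∧ (b =ᶠ d) ⟧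
        ≡⟨ cong₂ _+_ (⟦∧⟧ (a =ᶠ c) (H b d)) (⟦∧⟧ (G a c) (b =ᶠ d)) ⟩
      ⟦ a =ᶠ c ⟧ * ⟦ H b d ⟧ + ⟦ G a c ⟧ * ⟦ b =ᶠ d ⟧ ∎
    column : ∀ c → ∑[ d < m ] (⟦ G a c ⟧ * ⟦ b =ᶠ d ⟧) ≡ ⟦ G a c ⟧
    column c =
      trans (sum-cong-≗ (λ d → *-comm ⟦ G a c ⟧ ⟦ b =ᶠ d ⟧)) (∑-δ b (λ _ → ⟦ G a c ⟧))

Fin-subsingleton : ∀ {k} → k < 2 → (x y : Fin k) → x ≡ y
Fin-subsingleton k<2 x y = toℕ-injective (trans (toℕ≡0 x) (sym (toℕ≡0 y)))
  where
  toℕ≡0 : ∀ x → toℕ x ≡ 0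
  toℕ≡0 x = n<1⇒n≡0 (<-≤-trans (toℕ<n x) (s≤s⁻¹ k<2))

module Grid (n m : ℕ) where

  grid-sym : IsSymmetric (grid n m)
  grid-sym = cartesian-sym (pathGraph n) (pathGraph m) (path-sym n) (path-sym m)

  degree-grid : ∀ a b →
    degree (grid n m) (combine a b) ≡ degree (pathGraph n) a + degree (pathGraph m) b
  degree-grid = degree-cartesian (pathGraph n) (pathGraph m) (path-loopless n)

  row-edge : ∀ a {b b'} → T (pathGraph m b b') → T (grid n m (combine a b) (combine a b'))
  row-edge = cartesian-edgeʳ (pathGraph n) (pathGraph m)

  column-edge : ∀ {a a'} b → T (pathGraph n a a') → T (grid n m (combine a b) (combine a' b))
  column-edge = cartesian-edgeˡ (pathGraph n) (pathGraph m)

  grid-degree≤4 : ∀ u → degree (grid n m) u ≤ 4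
  grid-degree≤4 = combine-elim _ λ a b →
    subst (_≤ 4) (sym (degree-grid a b)) (+-mono-≤ (path-degree≤2 n a) (path-degree≤2 m b))

  grid-degree>0 : 2 ≤ n ⊎ 2 ≤ m → ∀ u → 0 < degree (grid n m) u
  grid-degree>0 2≤n⊎2≤m = combine-elim _ λ a b → subst (0 <_) (sym (degree-grid a b))
    ([ (λ 2≤n → ≤-trans (path-degree>0 n a 2≤n) (m≤m+n _ _))
     , (λ 2≤m → ≤-trans (path-degree>0 m b 2≤m) (m≤n+m _ _)) ]′ 2≤n⊎2≤m)

  module Spread (P : Fin (n * m) → Set)
    (P-spreads : ∀ u v → T (grid n m u v) → 2 ≤ degree (grid n m) v → P u → P v) where

    along-row : ∀ a {b b'} → 2 ≤ degree (grid n m) (combine a b') →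
      P (combine a b) → P (combine a b')
    along-row a {b} {b'} 2≤deg = PathWalk.path-walk (λ c → P (combine a c)) b' step b
      where
      step : ∀ c c' → T (pathGraph m c c') → Interior c' ⊎ c' ≡ b' →
        P (combine a c) → P (combine a c')
      step c c' c~c' (inj₁ interior) = P-spreads _ _ (row-edge a c~c')
        (subst (2 ≤_) (sym (degree-grid a c'))
          (≤-trans (interior⇒2≤path-degree m c' interior) (m≤n+m _ _)))
      step c c' c~c' (inj₂ refl) = P-spreads _ _ (row-edge a c~c') 2≤deg

    along-column : ∀ {a a'} b → 2 ≤ degree (grid n m) (combine a' b) →
      P (combine a b) → P (combine a' b)
    along-column {a} {a'} b 2≤deg = PathWalk.path-walk (λ c → P (combine c b)) a' step a
      where
      step : ∀ c c' → T (pathGraph n c c') → Interior c' ⊎ c' ≡ a' →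
        P (combine c b) → P (combine c' b)
      step c c' c~c' (inj₁ interior) = P-spreads _ _ (column-edge b c~c')
        (subst (2 ≤_) (sym (degree-grid c' b))
          (≤-trans (interior⇒2≤path-degree n c' interior) (m≤m+n _ _)))
      step c c' c~c' (inj₂ refl) = P-spreads _ _ (column-edge b c~c') 2≤deg

    spread : ∀ u w → P u → 2 ≤ degree (grid n m) w → P w
    spread = combine-elim _ λ a₀ b₀ → combine-elim _ λ a b P₀ 2≤deg →
      along-column b 2≤deg (to-row a₀ b₀ a b P₀ 2≤deg)
      where
      -- The corner (a₀, b) has degree ≥ 2 unless the row walk is trivial (m ≤ 1) or the
      -- corner is the target itself (n ≤ 1).
      to-row : ∀ a₀ b₀ a b → P (combine a₀ b₀) → 2 ≤ degree (grid n m) (combine a b) →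
        P (combine a₀ b)
      to-row a₀ b₀ a b P₀ 2≤deg with 2 ≤? m | 2 ≤? n
      ... | no m≱2  | _       =
        subst (λ c → P (combine a₀ c)) (Fin-subsingleton (≰⇒> m≱2) b₀ b) P₀
      ... | yes 2≤m | yes 2≤n = along-row a₀ (subst (2 ≤_) (sym (degree-grid a₀ b))
        (+-mono-≤ (path-degree>0 n a₀ 2≤n) (path-degree>0 m b 2≤m))) P₀
      ... | yes _   | no n≱2  = along-row a₀ (subst (λ c → 2 ≤ degree (grid n m) (combine c b))
                                                   (Fin-subsingleton (≰⇒> n≱2) a a₀) 2≤deg) P₀

*>0⇒>0ˡ : ∀ a b → 0 < a * b → 0 < a
*>0⇒>0ˡ (suc a) b _ = z<s

*≤4⇒≤2 : ∀ a b → 2 ≤ b → a * b ≤ 4 → a ≤ 2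
*≤4⇒≤2 a b 2≤b ab≤4 = *-cancelʳ-≤ a 2 2 (≤-trans (*-monoʳ-≤ a 2≤b) ab≤4)

3≤*⇒2≤ : ∀ a b → b ≤ 2 → 3 ≤ a * b → 2 ≤ a
3≤*⇒2≤ a b b≤2 3≤ab =
  *-cancelʳ-< b 1 a (≤-trans (s≤s (subst (_≤ 2) (sym (*-identityˡ b)) b≤2)) 3≤ab)

≱2⇒≤1 : ∀ {a} → ¬ (2 ≤ a) → a ≤ 1
≱2⇒≤1 a≱2 = s≤s⁻¹ (≰⇒> a≱2)

some-side≥2 : ∀ {n m} → 1 ≤ n → 1 ≤ m → ¬ (n ≡ 1 × m ≡ 1) → 2 ≤ n ⊎ 2 ≤ m
some-side≥2 {suc (suc _)} _ _ _ = inj₁ (s≤s (s≤s z≤n))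
some-side≥2 {suc zero} {suc (suc _)} _ _ _ = inj₂ (s≤s (s≤s z≤n))
some-side≥2 {suc zero} {suc zero} _ _ not-1×1 = ⊥-elim (not-1×1 (refl , refl))

module GridFactorization (n m : ℕ) (2≤n⊎2≤m : 2 ≤ n ⊎ 2 ≤ m)
  {H K : Graph (n * m)} (H-sym : IsSymmetric H) (K-sym : IsSymmetric K)
  (grid≡HK : Factors (grid n m) H K) where

  open Grid n m

  d h k : Fin (n * m) → ℕ
  d = degree (grid n m)
  h = degree H
  k = degree K

  d≡h*k : ∀ v → d v ≡ h v * k v
  d≡h*k = Factorization.degree-multiplicative grid-sym H-sym K-sym grid≡HK

  h*k≤4 : ∀ v → h v * k v ≤ 4
  h*k≤4 v = subst (_≤ 4) (d≡h*k v) (grid-degree≤4 v)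

  h>0 : ∀ v → 0 < h v
  h>0 v = *>0⇒>0ˡ (h v) (k v) (subst (0 <_) (d≡h*k v) (grid-degree>0 2≤n⊎2≤m v))

  k>0 : ∀ v → 0 < k v
  k>0 v = *>0⇒>0ˡ (k v) (h v)
    (subst (0 <_) (trans (d≡h*k v) (*-comm (h v) (k v))) (grid-degree>0 2≤n⊎2≤m v))

  mix : ∀ {x y} → T (grid n m x y) → ∃ λ l → h l ≡ h y × k l ≡ k x
  mix = edge⇒mixed-degrees grid-sym H-sym K-sym grid≡HK

  edge-sym : ∀ {x y} → T (grid n m x y) → T (grid n m y x)
  edge-sym {x} {y} = subst T (grid-sym x y)

  BothBranch : Fin (n * m) → Set
  BothBranch v = 2 ≤ h v × 2 ≤ k v

  both-branch-spreads : ∀ {v x} → BothBranch v → T (grid n m v x) → 3 ≤ d x → BothBranch x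
  both-branch-spreads {v} {x} (2≤hv , 2≤kv) v~x 3≤dx =
    3≤*⇒2≤ (h x) (k x) kx≤2 3≤hx*kx ,
    3≤*⇒2≤ (k x) (h x) hx≤2 (subst (3 ≤_) (*-comm (h x) (k x)) 3≤hx*kx)
    where
    3≤hx*kx : 3 ≤ h x * k x
    3≤hx*kx = subst (3 ≤_) (d≡h*k x) 3≤dx
    hx≤2 : h x ≤ 2
    hx≤2 = let l , hl≡hx , kl≡kv = mix v~x in
      subst (_≤ 2) hl≡hx (*≤4⇒≤2 (h l) (k l) (subst (2 ≤_) (sym kl≡kv) 2≤kv) (h*k≤4 l))
    kx≤2 : k x ≤ 2
    kx≤2 = let l , hl≡hv , kl≡kx = mix (edge-sym v~x) in
      subst (_≤ 2) kl≡kx (*≤4⇒≤2 (k l) (h l) (subst (2 ≤_) (sym hl≡hv) 2≤hv)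
        (subst (_≤ 4) (*-comm (h l) (k l)) (h*k≤4 l)))

  both-branch⇒4≤d : ∀ {v} → BothBranch v → 4 ≤ d v
  both-branch⇒4≤d {v} (2≤hv , 2≤kv) = subst (4 ≤_) (sym (d≡h*k v)) (*-mono-≤ 2≤hv 2≤kv)

  -- Branching of both factors forces degree 4, i.e. both path degrees 2.  Walking down column b
  -- it persists (degrees there are ≥ 3) up to row 0, whose path degree is ≤ 1.
  ¬both-branch : ∀ v → ¬ BothBranch v
  ¬both-branch = combine-elim _ ¬both-branch-at
    where
    4≤degrees : ∀ a b → BothBranch (combine a b) →
      4 ≤ degree (pathGraph n) a + degree (pathGraph m) b
    4≤degrees a b both = subst (4 ≤_) (degree-grid a b) (both-branch⇒4≤d both)

    row-degree : ∀ a b → BothBranch (combine a b) → 2 ≤ degree (pathGraph n) a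
    row-degree a b both = +-cancelʳ-≤ 2 2 (degree (pathGraph n) a)
      (≤-trans (4≤degrees a b both) (+-monoʳ-≤ (degree (pathGraph n) a) (path-degree≤2 m b)))

    column-degree : ∀ a b → BothBranch (combine a b) → 2 ≤ degree (pathGraph m) b
    column-degree a b both = +-cancelˡ-≤ 2 2 (degree (pathGraph m) b)
      (≤-trans (4≤degrees a b both) (+-monoˡ-≤ (degree (pathGraph m) b) (path-degree≤2 n a)))

    ¬both-branch-at : ∀ a b → ¬ BothBranch (combine a b)
    ¬both-branch-at a b both = n≮0 (subst (0 <_) (toℕ-fromℕ< 0<n)
      (2≤path-degree⇒0< n top (row-degree top b both-at-top)))
      where
      0<n : 0 < n
      0<n = ≤-<-trans z≤n (toℕ<n a)
      top : Fin n
      top = fromℕ< 0<n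
      step : ∀ c c' → T (pathGraph n c c') → Interior c' ⊎ c' ≡ top →
        BothBranch (combine c b) → BothBranch (combine c' b)
      step c c' c~c' _ both-c = both-branch-spreads both-c (column-edge b c~c')
        (subst (3 ≤_) (sym (degree-grid c' b))
          (+-mono-≤ (edge⇒degree>0 (pathGraph n) (subst T (path-sym n c c') c~c'))
                    (column-degree c b both-c)))
      both-at-top : BothBranch (combine top b)
      both-at-top = PathWalk.path-walk (λ c → BothBranch (combine c b)) top step a both

  h-branch-spreads : ∀ x y → T (grid n m x y) → 2 ≤ d y → 2 ≤ h x → 2 ≤ h y
  h-branch-spreads x y x~y 2≤dy 2≤hx =
    let l , hl≡hx , kl≡ky = mix (edge-sym x~y)
        kl≤1 = ≱2⇒≤1 λ 2≤kl → ¬both-branch l (subst (2 ≤_) (sym hl≡hx) 2≤hx , 2≤kl)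
    in  ≤-trans 2≤dy (begin
          d y          ≡⟨ d≡h*k y ⟩
          h y * k y    ≤⟨ *-monoʳ-≤ (h y) (subst (_≤ 1) kl≡ky kl≤1) ⟩
          h y * 1      ≡⟨ *-identityʳ (h y) ⟩
          h y          ∎)
    where open ≤-Reasoning

  h-branch⇒K-perfect : ∀ u → 2 ≤ h u → IsPerfectMatching K
  h-branch⇒K-perfect u 2≤hu w = ≤-antisym (≱2⇒≤1 k-branch) (k>0 w)
    where
    k-branch : ¬ (2 ≤ k w)
    k-branch 2≤kw =
      ¬both-branch w (Spread.spread (λ v → 2 ≤ h v) h-branch-spreads u w 2≤hu 2≤dw , 2≤kw)
      where
      2≤dw : 2 ≤ d w
      2≤dw = ≤-trans 2≤kw
        (subst (k w ≤_) (sym (d≡h*k w)) (m≤n*m (k w) (h w) {{>-nonZero (h>0 w)}}))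

  perfect-matching : IsPerfectMatching H ⊎ IsPerfectMatching K
  perfect-matching with all? (λ v → h v ≟ 1)
  ... | yes h≡1 = inj₁ h≡1
  ... | no ¬h≡1 = let u , hu≢1 = ¬∀⟶∃¬ (n * m) (λ v → h v ≡ 1) (λ v → h v ≟ 1) ¬h≡1
                  in  inj₂ (h-branch⇒K-perfect u (≤∧≢⇒< (h>0 u) (hu≢1 ∘ sym)))

mainTheorem17 : ∀ (n m : ℕ) → 1 ≤ n → 1 ≤ m → ¬ (n ≡ 1 × m ≡ 1) →
    IsPrime (grid n m)
mainTheorem17 n m 1≤n 1≤m not-1×1 H K (H-sym , _) (K-sym , _) grid≡HK =
  GridFactorization.perfect-matching n m (some-side≥2 1≤n 1≤m not-1×1) H-sym K-sym grid≡HK
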